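{- A planar bubble (with colors $\{1,2,3\}$) without bicolored cycles of length 2 has at least six bicolored cycles of length 4.
   Context: A bubble is a finite connected bipartite graph (black/white vertices, multiple edges allowed) with edges colored in $\{1,2,3\}$, each vertex having exactly one incident edge of each color. A bicolored cycle with colors $\{a,b\}$ is a connected component of the subgraph of edges of colors $a,b$; its length is its number of edges. A bubble is planar if its canonical embedding as a combinatorial map (cyclic order of incident colors $(1,2,3)$ counterclockwise around white vertices and $(1,3,2)$ around black vertices, so that the faces are exactly the bicolored cycles) has genus 0. -}

module Defs where

open import Data.Nat using (ℕ; zero; suc; _+_; _*_; _<ᵇ_; _≡ᵇ_)
open import Data.Bool using (Bool; true; false; not; _∧_; if_then_else_)
open import Data.Fin as F using (Fin; toℕ; _≟_)
open import Data.Fin.Permutation using (Permutation′; _⟨$⟩ʳ_; _⟨$⟩ˡ_)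
open import Data.List using (List; []; _∷_; upTo; allFin; map)
open import Data.Bool.ListAction using (and)
open import Data.Nat.ListAction using (sum)
open import Data.Product using (∃; _×_; _,_)
open import Data.Sum using (_⊎_; inj₁; inj₂)
open import Relation.Nullary.Decidable using (⌊_⌋)
open import Relation.Binary.PropositionalEquality using (_≡_)
open import Relation.Binary.Construct.Closure.ReflexiveTransitive using (Star)

Color : Set
Color = Fin 3

-- A 3-colored bipartite cubic graph with n white and n black vertices
-- (white and black counts agree since color-1 edges form a perfect matching).
-- White vertex w is joined by its edge of color c to black vertex (σ c ⟨$⟩ʳ w).
-- Each vertex then has exactly one incident edge of each color; multiple edges allowed.
record ColoredGraph : Set where
  field
    n : ℕ
    σ : Color → Permutation′ n
open ColoredGraph public

-- Vertices: inj₁ = white, inj₂ = black.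
Vertex : ColoredGraph → Set
Vertex G = Fin (n G) ⊎ Fin (n G)

data Adj (G : ColoredGraph) : Vertex G → Vertex G → Set where
  wb : ∀ w c → Adj G (inj₁ w) (inj₂ (σ G c ⟨$⟩ʳ w))
  bw : ∀ w c → Adj G (inj₂ (σ G c ⟨$⟩ʳ w)) (inj₁ w)

Connected : ColoredGraph → Set
Connected G = ∀ u v → Star (Adj G) u v

record Bubble : Set where
  field
    graph : ColoredGraph
    connected : Connected graph
open Bubble public

iter : ∀ {m} → (Fin m → Fin m) → ℕ → Fin m → Fin m
iter f zero x = x
iter f (suc k) x = f (iter f k x)

-- The bicolored path white w --a-- black --b-- white: the permutation
-- φ_{ab} = σ_b⁻¹ ∘ σ_a on white vertices.  The bicolored cycles with colors {a,b}
-- are in bijection with the orbits of φ_{ab}; the cycle through w has length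
-- 2 · (size of the orbit of w).
face : (G : ColoredGraph) → Color → Color → Fin (n G) → Fin (n G)
face G a b w = σ G b ⟨$⟩ˡ (σ G a ⟨$⟩ʳ w)

isRep : ∀ {m} → (Fin m → Fin m) → Fin m → Bool
isRep {m} f x = and (map (λ k → not (toℕ (iter f k x) <ᵇ toℕ x)) (upTo m))

-- Orbit size: least k ∈ {1..m} with f^k x = x (default m, never used for permutations).
orbitSizeFrom : ∀ {m} → (Fin m → Fin m) → Fin m → List ℕ → ℕ → ℕ
orbitSizeFrom f x [] d = d
orbitSizeFrom f x (k ∷ ks) d = if ⌊ iter f k x ≟ x ⌋ then k else orbitSizeFrom f x ks d

orbitSize : ∀ {m} → (Fin m → Fin m) → Fin m → ℕ
orbitSize {m} f x = orbitSizeFrom f x (map suc (upTo m)) m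

countOrbits : ∀ {m} → (Fin m → Fin m) → (ℕ → Bool) → ℕ
countOrbits {m} f P =
  sum (map (λ x → if isRep f x ∧ P (orbitSize f x) then 1 else 0) (allFin m))

colorPairs : List (Color × Color)
colorPairs = (F.zero , F.suc F.zero) ∷ (F.zero , F.suc (F.suc F.zero))
           ∷ (F.suc F.zero , F.suc (F.suc F.zero)) ∷ []

countBicycles : ColoredGraph → (ℕ → Bool) → ℕ
countBicycles G P =
  sum (map (λ { (a , b) → countOrbits (face G a b) (λ s → P (2 * s)) }) colorPairs)

-- Total number of bicolored cycles = number of faces of the canonical embedding.
numFaces : ColoredGraph → ℕ
numFaces G = countBicycles G (λ _ → true)

numCyclesOfLength : ColoredGraph → ℕ → ℕ
numCyclesOfLength G L = countBicycles G (λ l → l ≡ᵇ L)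

-- Planar: genus 0 of the canonical (connected) map, i.e. Euler's relation
-- V − E + F = 2 with V = 2n, E = 3n, F = number of bicolored cycles.
-- Written without subtraction: V + F = E + 2.
Planar : Bubble → Set
Planar B = 2 * n (graph B) + numFaces (graph B) ≡ 3 * n (graph B) + 2

module Submission where

open import Defs
open import Data.Nat using (_≤_)
open import Relation.Binary.PropositionalEquality using (_≡_)

-- For a permutation f of an m-element set, write c₁, c₂, c≥3 for its numbers
-- of cycles of length 1, 2 and ≥ 3.  Since every cycle of length ≥ 3 uses at
-- least three points, m ≥ c₁ + 2c₂ + 3c≥3, i.e.
--     3 · (number of cycles of f)  ≤  m + 2c₁ + c₂.                      (★)
-- Cycles are counted through their minimal points (`isRep`), so instead of
-- partitioning Fin m into cycles we prove (★) by a double counting: for every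
-- point y at most one of  "y is a representative",  "f y represents a cycle
-- of length ≥ 2",  "f² y represents a cycle of length ≥ 3"  holds, and
-- shifting the summation variable by the permutation f does not change a sum.
--
-- The bicolored cycles of a colored graph with colors {a,b} are the cycles of
-- the permutation σ_b⁻¹σ_a of the n white vertices, with twice the length.
-- Summing (★) over the three color pairs gives
--     3F ≤ 3n + 2·#(2-cycles) + #(4-cycles),
-- where F is the number of faces.  Planarity says F = n + 2, and if there are
-- no bicolored 2-cycles this leaves 6 ≤ #(4-cycles).

open import Data.Nat using (ℕ; zero; suc; _+_; _*_; _<ᵇ_; _≡ᵇ_; z≤n)
open import Data.Nat.Properties hiding (_≟_)
open import Data.Nat.DivMod using (_%_; _/_; m≡m%n+[m/n]*n; m%n<n)
open import Data.Nat.ListAction using (sum)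
open import Data.Nat.Tactic.RingSolver using (solve-∀)
open import Data.Bool using (Bool; true; false; not; _∧_; if_then_else_; T)
open import Data.Bool.Properties using (∧-zeroʳ)
open import Data.Bool.ListAction using (and)
open import Data.Fin as F using (Fin; toℕ; _≟_)
open import Data.Fin.Properties using (toℕ-injective; pigeonhole; toℕ<n)
open import Data.Fin.Permutation using (Permutation′; _⟨$⟩ʳ_; _⟨$⟩ˡ_; inverseˡ; _∘ₚ_; flip)
open import Data.List using (List; []; _∷_; upTo; allFin; map; length; tabulate)
open import Data.List.Properties using (map-tabulate; length-tabulate)
open import Data.List.Relation.Unary.All using (All; []; _∷_)
open import Data.List.Relation.Unary.All.Properties using (applyUpTo⁻)
open import Data.Product using (∃; _×_; _,_)
open import Data.Sum using (_⊎_; inj₁; inj₂)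
open import Data.Unit using (tt)
open import Data.Empty using (⊥; ⊥-elim)
open import Relation.Nullary using (yes; no)
open import Relation.Binary.PropositionalEquality
  using (refl; sym; trans; cong; cong₂; subst; module ≡-Reasoning)
import Algebra.Properties.CommutativeMonoid.Sum as CommutativeMonoidSum
open import Algebra.Properties.CommutativeSemigroup +-commutativeSemigroup
  using () renaming (interchange to +-interchange)

ind : Bool → ℕ
ind b = if b then 1 else 0

module _ {A : Set} where

  sum-map-+ : (h k : A → ℕ) (xs : List A) →
    sum (map (λ x → h x + k x) xs) ≡ sum (map h xs) + sum (map k xs)
  sum-map-+ h k [] = refl
  sum-map-+ h k (x ∷ xs) =
    trans (cong (h x + k x +_) (sum-map-+ h k xs)) (+-interchange (h x) (k x) _ _)

  sum-map-* : (k : ℕ) (h : A → ℕ) (xs : List A) →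
    sum (map (λ x → k * h x) xs) ≡ k * sum (map h xs)
  sum-map-* k h [] = sym (*-zeroʳ k)
  sum-map-* k h (x ∷ xs) =
    trans (cong (k * h x +_) (sum-map-* k h xs)) (sym (*-distribˡ-+ k (h x) _))

  sum-map-mono : (h k : A → ℕ) → (∀ x → h x ≤ k x) → (xs : List A) →
    sum (map h xs) ≤ sum (map k xs)
  sum-map-mono h k h≤k [] = z≤n
  sum-map-mono h k h≤k (x ∷ xs) = +-mono-≤ (h≤k x) (sum-map-mono h k h≤k xs)

  sum-map-≤-length : (h : A → ℕ) → (∀ x → h x ≤ 1) → (xs : List A) →
    sum (map h xs) ≤ length xs
  sum-map-≤-length h h≤1 [] = z≤n
  sum-map-≤-length h h≤1 (x ∷ xs) = +-mono-≤ (h≤1 x) (sum-map-≤-length h h≤1 xs)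

total : ∀ {m} → (Fin m → ℕ) → ℕ
total {m} h = sum (map h (allFin m))

total-+₃ : ∀ {m} (h k l : Fin m → ℕ) →
  total (λ x → h x + k x + l x) ≡ total h + total k + total l
total-+₃ {m} h k l =
  trans (sum-map-+ _ l (allFin m)) (cong (_+ total l) (sum-map-+ h k (allFin m)))

total-≤-size : ∀ {m} (h : Fin m → ℕ) → (∀ x → h x ≤ 1) → total h ≤ m
total-≤-size {m} h h≤1 =
  subst (total h ≤_) (length-tabulate {n = m} (λ i → i)) (sum-map-≤-length h h≤1 (allFin m))

module ℕ-Sum = CommutativeMonoidSum +-0-commutativeMonoid

-- `total` agrees with the library's sum of a vector, which knows that sums
-- are invariant under permutations of the index set.
total≡sum : ∀ {m} (h : Fin m → ℕ) → total h ≡ ℕ-Sum.sum h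
total≡sum {zero} h = refl
total≡sum {suc m} h = cong (h F.zero +_) (trans (cong sum shift) (total≡sum (λ i → h (F.suc i))))
  where
  shift : map h (tabulate F.suc) ≡ map (λ i → h (F.suc i)) (allFin m)
  shift = trans (map-tabulate F.suc h) (sym (map-tabulate (λ i → i) (λ i → h (F.suc i))))

total-permute : ∀ {m} (π : Permutation′ m) (h : Fin m → ℕ) →
  total (λ x → h (π ⟨$⟩ʳ x)) ≡ total h
total-permute π h =
  trans (total≡sum (λ x → h (π ⟨$⟩ʳ x))) (trans (sym (ℕ-Sum.sum-permute h π)) (sym (total≡sum h)))

at-most-one : ∀ a b c → (a ≡ true → b ≡ true → ⊥) → (a ≡ true → c ≡ true → ⊥) →
  (b ≡ true → c ≡ true → ⊥) → ind a + ind b + ind c ≤ 1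
at-most-one true  true  _     a#b a#c b#c = ⊥-elim (a#b refl refl)
at-most-one true  false true  a#b a#c b#c = ⊥-elim (a#c refl refl)
at-most-one false true  true  a#b a#c b#c = ⊥-elim (b#c refl refl)
at-most-one true  false false a#b a#c b#c = ≤-refl
at-most-one false true  false a#b a#c b#c = ≤-refl
at-most-one false false true  a#b a#c b#c = ≤-refl
at-most-one false false false a#b a#c b#c = z≤n

-- The weight 3 of a cycle representative r, split according to whether its
-- cycle has length 1 (e₁), 2 (e₂) or more:  3 ≤ 1 + [≥2] + [≥3] + 2[=1] + [=2].
cycle-weight : ∀ r e₁ e₂ →
  3 * ind (r ∧ true) ≤
    ind r + ind (r ∧ not e₁) + ind (r ∧ (not e₁ ∧ not e₂)) + 2 * ind (r ∧ e₁) + ind (r ∧ e₂)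
cycle-weight false e₁    e₂    = z≤n
cycle-weight true  true  e₂    = ≤ᵇ⇒≤ 3 _ tt
cycle-weight true  false true  = ≤ᵇ⇒≤ 3 _ tt
cycle-weight true  false false = ≤ᵇ⇒≤ 3 _ tt

fixed-orbitSize : ∀ {m} (f : Fin m → Fin m) z → f z ≡ z → orbitSize f z ≡ 1
fixed-orbitSize {suc m} f z fz≡z with f z ≟ z
... | yes _ = refl
... | no fz≢z with fz≢z fz≡z
...   | ()

involutive-orbitSize : ∀ {m} (f : Fin m → Fin m) z → f (f z) ≡ z →
  orbitSize f z ≡ 1 ⊎ orbitSize f z ≡ 2
involutive-orbitSize {suc zero} f z _ with f z ≟ z
... | yes _ = inj₁ refl
... | no  _ = inj₁ refl
involutive-orbitSize {suc (suc m)} f z ffz≡z with f z ≟ z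
... | yes _ = inj₁ refl
... | no  _ with f (f z) ≟ z
...   | yes _ = inj₂ refl
...   | no ffz≢z with ffz≢z ffz≡z
...     | ()

and-All : ∀ {A : Set} (h : A → Bool) (xs : List A) →
  and (map h xs) ≡ true → All (λ x → h x ≡ true) xs
and-All h [] _ = []
and-All h (x ∷ xs) all-true with h x in hx
... | true = hx ∷ and-All h xs all-true

not-<ᵇ⇒≥ : ∀ a b → not (a <ᵇ b) ≡ true → b ≤ a
not-<ᵇ⇒≥ a b _ with a <ᵇ b in a<ᵇb
... | false = ≮⇒≥ (λ a<b → subst T a<ᵇb (<⇒<ᵇ a<b))

module Orbits {m : ℕ} (π : Permutation′ m) where

  f : Fin m → Fin m
  f = π ⟨$⟩ʳ_

  iter-+ : ∀ i j x → iter f (i + j) x ≡ iter f i (iter f j x)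
  iter-+ zero    j x = refl
  iter-+ (suc i) j x = cong f (iter-+ i j x)

  iter-injective : ∀ k {x y} → iter f k x ≡ iter f k y → x ≡ y
  iter-injective zero    eq = eq
  iter-injective (suc k) {x} {y} eq = iter-injective k (begin
    iter f k x             ≡⟨ inverseˡ π ⟨
    π ⟨$⟩ˡ iter f (suc k) x ≡⟨ cong (π ⟨$⟩ˡ_) eq ⟩
    π ⟨$⟩ˡ iter f (suc k) y ≡⟨ inverseˡ π ⟩
    iter f k y             ∎)
    where open ≡-Reasoning

  iter-period : ∀ p x → iter f p x ≡ x → ∀ q → iter f (q * p) x ≡ x
  iter-period p x fᵖx≡x zero    = refl
  iter-period p x fᵖx≡x (suc q) =
    trans (iter-+ p (q * p) x) (trans (cong (iter f p) (iter-period p x fᵖx≡x q)) fᵖx≡x)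

  -- Every point returns to itself after some number 1 + p ≤ m of steps:
  -- by pigeonhole two of x, f x, …, fᵐ x coincide, and f is injective.
  period : ∀ x → ∃ λ p → iter f (suc p) x ≡ x × suc p ≤ m
  period x with pigeonhole (n<1+n m) (λ (i : Fin (suc m)) → iter f (toℕ i) x)
  ... | i , j , i<j , fⁱx≡fʲx with m≤n⇒∃[o]m+o≡n i<j
  ... | o , i+1+o≡j = o , sym (iter-injective (toℕ i) fⁱx≡fⁱ⁺¹⁺ᵒx) , 1+o≤m
    where
    open ≡-Reasoning
    j≡i+1+o : toℕ j ≡ toℕ i + suc o
    j≡i+1+o = trans (sym i+1+o≡j) (sym (+-suc (toℕ i) o))
    fⁱx≡fⁱ⁺¹⁺ᵒx : iter f (toℕ i) x ≡ iter f (toℕ i) (iter f (suc o) x)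
    fⁱx≡fⁱ⁺¹⁺ᵒx = begin
      iter f (toℕ i) x                   ≡⟨ fⁱx≡fʲx ⟩
      iter f (toℕ j) x                   ≡⟨ cong (λ k → iter f k x) j≡i+1+o ⟩
      iter f (toℕ i + suc o) x           ≡⟨ iter-+ (toℕ i) (suc o) x ⟩
      iter f (toℕ i) (iter f (suc o) x)  ∎
    1+o≤m : suc o ≤ m
    1+o≤m = ≤-trans (m≤n+m (suc o) (toℕ i))
      (subst (_≤ m) j≡i+1+o (≤-pred (toℕ<n j)))

  -- A representative is the minimum of its whole orbit, not only of the
  -- first m iterates that `isRep` inspects: fʲ x = f^(j mod period) x.
  rep-minimal : ∀ x → isRep f x ≡ true → ∀ j → toℕ x ≤ toℕ (iter f j x)
  rep-minimal x rep j with period x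
  ... | p , fᵖ⁺¹x≡x , p+1≤m = subst (λ z → toℕ x ≤ toℕ z) (sym fʲx≡fʳx) x≤fʳx
    where
    open ≡-Reasoning
    r = j % suc p
    x≤fʳx : toℕ x ≤ toℕ (iter f r x)
    x≤fʳx = not-<ᵇ⇒≥ _ _ (applyUpTo⁻ (λ k → k) m
      (and-All (λ k → not (toℕ (iter f k x) <ᵇ toℕ x)) (upTo m) rep)
      (<-≤-trans (m%n<n j (suc p)) p+1≤m))
    fʲx≡fʳx : iter f j x ≡ iter f r x
    fʲx≡fʳx = begin
      iter f j x                                 ≡⟨ cong (λ k → iter f k x) (m≡m%n+[m/n]*n j (suc p)) ⟩
      iter f (r + (j / suc p) * suc p) x         ≡⟨ iter-+ r _ x ⟩
      iter f r (iter f ((j / suc p) * suc p) x)  ≡⟨ cong (iter f r) (iter-period (suc p) x fᵖ⁺¹x≡x (j / suc p)) ⟩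
      iter f r x                                 ∎

  reps-coincide : ∀ k x → isRep f x ≡ true → isRep f (iter f k x) ≡ true → iter f k x ≡ x
  reps-coincide k x rep-x rep-fᵏx with period x
  ... | p , fᵖ⁺¹x≡x , _ = toℕ-injective (≤-antisym fᵏx≤x (rep-minimal x rep-x k))
    where
    back : iter f (p * k) (iter f k x) ≡ x
    back = trans (sym (iter-+ (p * k) k x))
      (trans (cong (λ l → iter f l x) (trans (+-comm (p * k) k) (*-comm (suc p) k)))
             (iter-period (suc p) x fᵖ⁺¹x≡x k))
    fᵏx≤x : toℕ (iter f k x) ≤ toℕ x
    fᵏx≤x = subst (λ z → toℕ (iter f k x) ≤ toℕ z) back (rep-minimal (iter f k x) rep-fᵏx (p * k))

  module _ (one? two? : ℕ → Bool) (one?-1 : one? 1 ≡ true) (two?-2 : two? 2 ≡ true) where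

    rep : Fin m → Bool
    rep = isRep f

    -- x represents an orbit rejected by one? (resp. by one? and two?); in
    -- particular an orbit of size ≥ 2 (resp. ≥ 3).
    long₂ long₃ : Fin m → Bool
    long₂ x = rep x ∧ not (one? (orbitSize f x))
    long₃ x = rep x ∧ (not (one? (orbitSize f x)) ∧ not (two? (orbitSize f x)))

    long₂-fixed : ∀ z → f z ≡ z → long₂ z ≡ false
    long₂-fixed z fz≡z rewrite fixed-orbitSize f z fz≡z | one?-1 = ∧-zeroʳ (rep z)

    long₃-involutive : ∀ z → f (f z) ≡ z → long₃ z ≡ false
    long₃-involutive z ffz≡z with involutive-orbitSize f z ffz≡z
    ... | inj₁ size≡1 rewrite size≡1 | one?-1 = ∧-zeroʳ (rep z)
    ... | inj₂ size≡2 rewrite size≡2 | two?-2 =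
      trans (cong (rep z ∧_) (∧-zeroʳ (not (one? 2)))) (∧-zeroʳ (rep z))

    -- For each y at most one of: y is a representative, f y is long₂,
    -- f² y is long₃.  Two representatives in one orbit coincide, which
    -- would force f y or f² y to be fixed by f resp. f².
    spread : ∀ y → ind (rep y) + ind (long₂ (f y)) + ind (long₃ (f (f y))) ≤ 1
    spread y = at-most-one _ _ _ excl-rep-long₂ excl-rep-long₃ excl-long₂-long₃
      where
      rep-of : ∀ {a b} → a ∧ b ≡ true → a ≡ true
      rep-of {true} _ = refl
      clash : ∀ {b} → b ≡ false → b ≡ true → ⊥
      clash refl ()
      excl-rep-long₂ : rep y ≡ true → long₂ (f y) ≡ true → ⊥
      excl-rep-long₂ rep-y long-fy =
        clash (long₂-fixed (f y) (cong f (reps-coincide 1 y rep-y (rep-of long-fy)))) long-fy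
      excl-rep-long₃ : rep y ≡ true → long₃ (f (f y)) ≡ true → ⊥
      excl-rep-long₃ rep-y long-ffy =
        clash (long₃-involutive (f (f y))
                 (cong (λ z → f (f z)) (reps-coincide 2 y rep-y (rep-of long-ffy))))
              long-ffy
      excl-long₂-long₃ : long₂ (f y) ≡ true → long₃ (f (f y)) ≡ true → ⊥
      excl-long₂-long₃ long-fy long-ffy =
        clash (long₂-fixed (f y) (reps-coincide 1 (f y) (rep-of long-fy) (rep-of long-ffy)))
              long-fy

    -- Summing `spread` and reindexing the last two sums by f and f².
    spread-total : total (λ x → ind (rep x) + ind (long₂ x) + ind (long₃ x)) ≤ m
    spread-total = begin
      total (λ x → ind (rep x) + ind (long₂ x) + ind (long₃ x))
        ≡⟨ total-+₃ (λ x → ind (rep x)) (λ x → ind (long₂ x)) (λ x → ind (long₃ x)) ⟩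
      total (λ x → ind (rep x)) + total (λ x → ind (long₂ x)) + total (λ x → ind (long₃ x))
        ≡⟨ cong₂ (λ s t → total (λ x → ind (rep x)) + s + t) (sym (total-permute π (λ x → ind (long₂ x))))
             (sym (trans (total-permute π (λ x → ind (long₃ (f x)))) (total-permute π (λ x → ind (long₃ x))))) ⟩
      total (λ y → ind (rep y)) + total (λ y → ind (long₂ (f y))) + total (λ y → ind (long₃ (f (f y))))
        ≡⟨ total-+₃ (λ y → ind (rep y)) (λ y → ind (long₂ (f y))) (λ y → ind (long₃ (f (f y)))) ⟨
      total (λ y → ind (rep y) + ind (long₂ (f y)) + ind (long₃ (f (f y))))
        ≤⟨ total-≤-size _ spread ⟩
      m ∎
      where open ≤-Reasoning

    orbit-bound : 3 * countOrbits f (λ _ → true) ≤ m + 2 * countOrbits f one? + countOrbits f two?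
    orbit-bound = begin
      3 * countOrbits f (λ _ → true)
        ≡⟨ sum-map-* 3 _ (allFin m) ⟨
      total (λ x → 3 * ind (rep x ∧ true))
        ≤⟨ sum-map-mono _ _ (λ x → cycle-weight (rep x) (one? (orbitSize f x)) (two? (orbitSize f x))) (allFin m) ⟩
      total (λ x → weight x + 2 * ind (rep x ∧ one? (orbitSize f x)) + ind (rep x ∧ two? (orbitSize f x)))
        ≡⟨ total-+₃ weight _ _ ⟩
      total weight + total (λ x → 2 * ind (rep x ∧ one? (orbitSize f x))) + countOrbits f two?
        ≡⟨ cong (λ t → total weight + t + countOrbits f two?) (sum-map-* 2 _ (allFin m)) ⟩
      total weight + 2 * countOrbits f one? + countOrbits f two?
        ≤⟨ +-monoˡ-≤ (countOrbits f two?) (+-monoˡ-≤ (2 * countOrbits f one?) spread-total) ⟩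
      m + 2 * countOrbits f one? + countOrbits f two? ∎
      where
      open ≤-Reasoning
      weight : Fin m → ℕ
      weight x = ind (rep x) + ind (long₂ x) + ind (long₃ x)

sum-bounds : ∀ {A : Set} (n : ℕ) (t a b : A → ℕ) →
  (∀ x → 3 * t x ≤ n + 2 * a x + b x) → (xs : List A) →
  3 * sum (map t xs) ≤ length xs * n + 2 * sum (map a xs) + sum (map b xs)
sum-bounds n t a b bound [] = z≤n
sum-bounds n t a b bound (x ∷ xs) = begin
  3 * (t x + sum (map t xs))
    ≡⟨ *-distribˡ-+ 3 (t x) _ ⟩
  3 * t x + 3 * sum (map t xs)
    ≤⟨ +-mono-≤ (bound x) (sum-bounds n t a b bound xs) ⟩
  (n + 2 * a x + b x) + (length xs * n + 2 * sum (map a xs) + sum (map b xs))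
    ≡⟨ regroup n (length xs * n) (a x) _ (b x) _ ⟩
  n + length xs * n + 2 * (a x + sum (map a xs)) + (b x + sum (map b xs)) ∎
  where
  open ≤-Reasoning
  regroup : ∀ n N a A b B → (n + 2 * a + b) + (N + 2 * A + B) ≡ n + N + 2 * (a + A) + (b + B)
  regroup = solve-∀

-- The bicolored cycles with colors {a,b} are the orbits of the permutation
-- σ_b⁻¹σ_a of the white vertices, so (★) for the three color pairs gives
-- 3F ≤ 3n + 2·#(2-cycles) + #(4-cycles) for every colored graph.
faces-bound : (G : ColoredGraph) →
  3 * numFaces G ≤ 3 * n G + 2 * numCyclesOfLength G 2 + numCyclesOfLength G 4
faces-bound G =
  sum-bounds (n G)
    (λ (a , b) → countOrbits (face G a b) (λ _ → true))
    (λ (a , b) → countOrbits (face G a b) (λ s → 2 * s ≡ᵇ 2))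
    (λ (a , b) → countOrbits (face G a b) (λ s → 2 * s ≡ᵇ 4))
    (λ (a , b) → Orbits.orbit-bound (σ G a ∘ₚ flip (σ G b))
                   (λ s → 2 * s ≡ᵇ 2) (λ s → 2 * s ≡ᵇ 4) refl refl)
    colorPairs

planar-faces : (B : Bubble) → Planar B → numFaces (graph B) ≡ n (graph B) + 2
planar-faces B planar = +-cancelˡ-≡ (2 * n (graph B)) _ _
  (trans planar (split (n (graph B))))
  where
  split : ∀ n → 3 * n + 2 ≡ 2 * n + (n + 2)
  split = solve-∀

lemma4 : (B : Bubble) → Planar B → numCyclesOfLength (graph B) 2 ≡ 0 →
    6 ≤ numCyclesOfLength (graph B) 4
lemma4 B planar no-2-cycles = +-cancelˡ-≤ (3 * n G) 6 _ (begin
  3 * n G + 6                                                  ≡⟨ *-distribˡ-+ 3 (n G) 2 ⟨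
  3 * (n G + 2)                                                ≡⟨ cong (3 *_) (planar-faces B planar) ⟨
  3 * numFaces G                                               ≤⟨ faces-bound G ⟩
  3 * n G + 2 * numCyclesOfLength G 2 + numCyclesOfLength G 4  ≡⟨ cong (λ c → 3 * n G + 2 * c + numCyclesOfLength G 4) no-2-cycles ⟩
  3 * n G + 0 + numCyclesOfLength G 4                          ≡⟨ cong (_+ numCyclesOfLength G 4) (+-identityʳ (3 * n G)) ⟩
  3 * n G + numCyclesOfLength G 4                              ∎)
  where
  G = graph B
  open ≤-Reasoning
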